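{- Let $1\le v\le n$, $0\le k\le n$, $R=\min(v,n-k,k,n-v)$, and let $F$ be a field. The dual code (with respect to the standard bilinear form on $F^{J(n,v)}$) of a Johnson graph code $JGC(n,v,k,r)$ over $F$ is a Johnson graph code $JGC(n,v,n-k,R-r-1)$.
   Context: $E=\{0,1,\dots,n-1\}$; $J(n,v)$ is the set of $v$-element subsets of $E$ (vertices of the Johnson graph). For $A\subseteq E$ and integer $r$, $B_r(A)=\{L\in J(n,v):\min(|L\setminus A|,|A\setminus L|)\le r\}$; $|B_r(A)|$ depends only on $|A|$ and $r$. A linear code $C\subseteq F^{J(n,v)}$ (length $N=\binom nv$, coordinates indexed by $J(n,v)$) has a set $S$ of coordinates as an information set if $|S|=\dim C$ and the restriction map $C\to F^S$ is bijective. A Johnson graph code $JGC(n,v,k,r)$ is a linear code of length $N=\binom nv$ with coordinates indexed by $J(n,v)$, of dimension $|B_r(A)|$ for $|A|=k$, such that for every $k$-subset $A\subseteq E$ the set $B_r(A)$ is an information set. -}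

module Defs where

open import Level using (Level; _⊔_; suc)
open import Data.Nat as ℕ using (ℕ; zero; _⊓_; _∸_)
open import Data.Integer as ℤ using (ℤ; +_)
open import Data.Fin using (Fin)
open import Data.Fin.Subset using (Subset; _─_; ∣_∣)
open import Data.Vec using (_∷_; [])
open import Data.Bool using (true; false)
open import Data.Product using (Σ; Σ-syntax; ∃; ∃-syntax; _×_; _,_; proj₁)
open import Relation.Nullary using (¬_; yes; no)
open import Relation.Unary using (Pred)
open import Relation.Binary.PropositionalEquality using (_≡_)
open import Algebra.Bundles using (CommutativeRing)

record Field (c ℓ : Level) : Set (suc (c ⊔ ℓ)) where
  field
    commutativeRing : CommutativeRing c ℓ
  open CommutativeRing commutativeRing public
  field
    0≉1     : ¬ (0# ≈ 1#)
    inverse : ∀ x → ¬ (x ≈ 0#) → ∃[ y ] (x * y ≈ 1#)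

J : ℕ → ℕ → Set
J n v = Σ[ L ∈ Subset n ] (∣ L ∣ ≡ v)

Ball : ∀ {n v} → ℤ → Subset n → Pred (J n v) Level.zero
Ball r A (L , _) = + (∣ L ─ A ∣ ⊓ ∣ A ─ L ∣) ℤ.≤ r

-- Number of elements of a set S of coordinates: S has exactly d elements,
-- i.e. there is an injective enumeration Fin d → S that hits every element of S
-- (elements of J compared by their underlying subsets).
Card : ∀ {n v ℓ} → Pred (J n v) ℓ → ℕ → Set ℓ
Card {n} {v} S d =
  Σ[ e ∈ (Fin d → J n v) ]
    ((∀ i → S (e i))
    × (∀ i j → proj₁ (e i) ≡ proj₁ (e j) → i ≡ j)
    × (∀ L → S L → ∃[ i ] (proj₁ (e i) ≡ proj₁ L)))

module _ {c ℓ : Level} (F : Field c ℓ) where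
  open Field F

  -- words of length N = binom n v, coordinates indexed by J(n,v)
  Word : ℕ → ℕ → Set c
  Word n v = J n v → Carrier

  _≋_ : ∀ {n v} → Word n v → Word n v → Set ℓ
  w ≋ w' = ∀ L → w L ≈ w' L

  zeroW : ∀ {n v} → Word n v
  zeroW _ = 0#

  _⊕_ : ∀ {n v} → Word n v → Word n v → Word n v
  (w ⊕ w') L = w L + w' L

  _⊛_ : ∀ {n v} → Carrier → Word n v → Word n v
  (a ⊛ w) L = a * w L

  record IsLinearCode {n v ℓ'} (C : Pred (Word n v) ℓ') : Set (c ⊔ ℓ ⊔ ℓ') where
    field
      respects : ∀ {w w'} → w ≋ w' → C w → C w'
      has-zero : C zeroW
      closed-+ : ∀ {w w'} → C w → C w' → C (w ⊕ w')
      closed-* : ∀ a {w} → C w → C (a ⊛ w)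

  sumFin : ∀ d → (Fin d → Carrier) → Carrier
  sumFin zero    f = 0#
  sumFin (ℕ.suc d) f = f Fin.zero + sumFin d (λ i → f (Fin.suc i))
    where import Data.Fin as Fin

  lincomb : ∀ {n v d} → (Fin d → Carrier) → (Fin d → Word n v) → Word n v
  lincomb {d = d} a b L = sumFin d (λ i → a i * b i L)

  HasDim : ∀ {n v ℓ'} → Pred (Word n v) ℓ' → ℕ → Set (c ⊔ ℓ ⊔ ℓ')
  HasDim {n} {v} C d =
    Σ[ b ∈ (Fin d → Word n v) ]
      ((∀ i → C (b i))
      × (∀ w → C w → ∃[ a ] (w ≋ lincomb a b))
      × (∀ a → lincomb a b ≋ zeroW → ∀ i → a i ≈ 0#))

  IsInformationSet : ∀ {n v ℓ' ℓs} → Pred (Word n v) ℓ' → Pred (J n v) ℓs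
                   → Set (c ⊔ ℓ ⊔ ℓ' ⊔ ℓs)
  IsInformationSet {n} {v} C S =
    (∃[ d ] (HasDim C d × Card S d))
    × (∀ w w' → C w → C w' → (∀ L → S L → w L ≈ w' L) → w ≋ w')
    × (∀ (f : Σ (J n v) S → Carrier) →
         ∃[ w ] (C w × (∀ L (s : S L) → w L ≈ f (L , s))))

  IsJGC : ∀ {ℓ'} (n v k : ℕ) (r : ℤ) → Pred (Word n v) ℓ' → Set (c ⊔ ℓ ⊔ ℓ')
  IsJGC n v k r C =
    IsLinearCode C
    × (∀ (A : Subset n) → ∣ A ∣ ≡ k →
         ∃[ d ] (HasDim C d × Card (Ball {n} {v} r A) d)
         × IsInformationSet C (Ball {n} {v} r A))

  sumSubsets : ∀ n → (Subset n → Carrier) → Carrier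
  sumSubsets zero      f = f []
  sumSubsets (ℕ.suc n) f = sumSubsets n (λ L → f (true ∷ L)) + sumSubsets n (λ L → f (false ∷ L))

  termAt : ∀ {n v} → Word n v → Word n v → Subset n → Carrier
  termAt {n} {v} w w' L with ∣ L ∣ ℕ.≟ v
  ... | yes p = w (L , p) * w' (L , p)
  ... | no  _ = 0#

  ⟨_,_⟩ : ∀ {n v} → Word n v → Word n v → Carrier
  ⟨_,_⟩ {n} w w' = sumSubsets n (termAt w w')

  Dual : ∀ {n v ℓ'} → Pred (Word n v) ℓ' → Pred (Word n v) (c ⊔ ℓ ⊔ ℓ')
  Dual C w = ∀ w' → C w' → ⟨ w , w' ⟩ ≈ 0#

Rnum : ℕ → ℕ → ℕ → ℕ
Rnum n v k = v ⊓ (n ∸ k) ⊓ k ⊓ (n ∸ v)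

module Submission where

-- Let A be a k-set, A' = ∁ A, and L a v-set. The four cells L ∩ A', L ∖ A', A' ∖ L and
-- E ∖ (L ∪ A') have sizes x, y, z, u with v = x + y, n - k = x + z, k = y + u and
-- n - v = z + u, so  min(x, u) + min(y, z) = min(v, n - k, k, n - v) = R.  Hence L lies in
-- B_{R-r-1}(A') exactly when it does not lie in B_r(A): the two balls are complementary
-- in J(n,v).  It therefore suffices that the complement T of an information set S of a
-- linear code C is an information set of its dual.  Let u_L ∈ C (L ∈ S) be the codeword
-- restricting to the unit vector e_L on S; the u_L span C, so w ∈ C^⊥ iff
-- w_L = - Σ_{M ∈ T} w_M (u_L)_M for every L ∈ S.  Thus a dual word is determined by its
-- values on T, and every assignment of values on T extends to a dual word.

open import Defs
open import Level using (Level; _⊔_)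
open import Data.Nat using (ℕ; _≤_; _∸_)
open import Data.Integer using (ℤ; +_; _-_)
open import Relation.Unary using (Pred)

open import Data.Bool using (true; false; if_then_else_)
import Data.Bool.Properties as Bool
open import Data.Fin using (Fin; zero; suc; splitAt; join; _↑ˡ_; _↑ʳ_)
import Data.Fin.Properties as Finₚ
open import Data.Fin.Subset using (Subset; _─_; ∣_∣; ∁)
open import Data.Fin.Subset.Properties using (∣∁p∣≡n∸∣p∣)
import Data.Integer as Int
import Data.Integer.Properties as ℤₚ
open import Data.Integer.Solver using (module +-*-Solver)
import Data.Nat as Nat
import Data.Nat.Properties as ℕₚ
open import Data.Product using (Σ; Σ-syntax; ∃; ∃-syntax; _×_; _,_; proj₁; proj₂; map₂)
open import Data.Sum using (_⊎_; inj₁; inj₂)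
open import Data.Vec using (_∷_; [])
import Data.Vec.Properties as Vecₚ
open import Function using (_∘_; _⇔_; mk⇔; Equivalence)
open import Relation.Binary.PropositionalEquality as ≡ using (_≡_; _≢_; refl; cong; cong₂; subst)
open import Relation.Nullary using (¬_; yes; no; does; Irrelevant; contradiction)
open import Relation.Nullary.Decidable using (dec-true; dec-false; map′; ¬?)
open import Relation.Unary using (Decidable)

module _ where
  open Nat using (_+_; _⊓_)
  open ≡.≡-Reasoning

  ∣p─∁q∣+∣p─q∣≡∣p∣ : ∀ {n} (p q : Subset n) → ∣ p ─ ∁ q ∣ + ∣ p ─ q ∣ ≡ ∣ p ∣
  ∣p─∁q∣+∣p─q∣≡∣p∣ []          []          = refl
  ∣p─∁q∣+∣p─q∣≡∣p∣ (true ∷ p)  (true ∷ q)  = cong Nat.suc (∣p─∁q∣+∣p─q∣≡∣p∣ p q)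
  ∣p─∁q∣+∣p─q∣≡∣p∣ (true ∷ p)  (false ∷ q) = ≡.trans (ℕₚ.+-suc _ _) (cong Nat.suc (∣p─∁q∣+∣p─q∣≡∣p∣ p q))
  ∣p─∁q∣+∣p─q∣≡∣p∣ (false ∷ p) (true ∷ q)  = ∣p─∁q∣+∣p─q∣≡∣p∣ p q
  ∣p─∁q∣+∣p─q∣≡∣p∣ (false ∷ p) (false ∷ q) = ∣p─∁q∣+∣p─q∣≡∣p∣ p q

  ∣p─∁q∣+∣q─p∣≡∣q∣ : ∀ {n} (p q : Subset n) → ∣ p ─ ∁ q ∣ + ∣ q ─ p ∣ ≡ ∣ q ∣
  ∣p─∁q∣+∣q─p∣≡∣q∣ []          []          = refl
  ∣p─∁q∣+∣q─p∣≡∣q∣ (true ∷ p)  (true ∷ q)  = cong Nat.suc (∣p─∁q∣+∣q─p∣≡∣q∣ p q)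
  ∣p─∁q∣+∣q─p∣≡∣q∣ (true ∷ p)  (false ∷ q) = ∣p─∁q∣+∣q─p∣≡∣q∣ p q
  ∣p─∁q∣+∣q─p∣≡∣q∣ (false ∷ p) (true ∷ q)  = ≡.trans (ℕₚ.+-suc _ _) (cong Nat.suc (∣p─∁q∣+∣q─p∣≡∣q∣ p q))
  ∣p─∁q∣+∣q─p∣≡∣q∣ (false ∷ p) (false ∷ q) = ∣p─∁q∣+∣q─p∣≡∣q∣ p q

  ∣p─q∣+∣∁q─p∣≡∣∁q∣ : ∀ {n} (p q : Subset n) → ∣ p ─ q ∣ + ∣ ∁ q ─ p ∣ ≡ ∣ ∁ q ∣
  ∣p─q∣+∣∁q─p∣≡∣∁q∣ []          []          = refl
  ∣p─q∣+∣∁q─p∣≡∣∁q∣ (true ∷ p)  (true ∷ q)  = ∣p─q∣+∣∁q─p∣≡∣∁q∣ p q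
  ∣p─q∣+∣∁q─p∣≡∣∁q∣ (true ∷ p)  (false ∷ q) = cong Nat.suc (∣p─q∣+∣∁q─p∣≡∣∁q∣ p q)
  ∣p─q∣+∣∁q─p∣≡∣∁q∣ (false ∷ p) (true ∷ q)  = ∣p─q∣+∣∁q─p∣≡∣∁q∣ p q
  ∣p─q∣+∣∁q─p∣≡∣∁q∣ (false ∷ p) (false ∷ q) = ≡.trans (ℕₚ.+-suc _ _) (cong Nat.suc (∣p─q∣+∣∁q─p∣≡∣∁q∣ p q))

  ∣q─p∣+∣∁q─p∣≡∣∁p∣ : ∀ {n} (p q : Subset n) → ∣ q ─ p ∣ + ∣ ∁ q ─ p ∣ ≡ ∣ ∁ p ∣
  ∣q─p∣+∣∁q─p∣≡∣∁p∣ []          []          = refl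
  ∣q─p∣+∣∁q─p∣≡∣∁p∣ (true ∷ p)  (true ∷ q)  = ∣q─p∣+∣∁q─p∣≡∣∁p∣ p q
  ∣q─p∣+∣∁q─p∣≡∣∁p∣ (true ∷ p)  (false ∷ q) = ∣q─p∣+∣∁q─p∣≡∣∁p∣ p q
  ∣q─p∣+∣∁q─p∣≡∣∁p∣ (false ∷ p) (true ∷ q)  = cong Nat.suc (∣q─p∣+∣∁q─p∣≡∣∁p∣ p q)
  ∣q─p∣+∣∁q─p∣≡∣∁p∣ (false ∷ p) (false ∷ q) = ≡.trans (ℕₚ.+-suc _ _) (cong Nat.suc (∣q─p∣+∣∁q─p∣≡∣∁p∣ p q))

  ∣p∣≡n∸k⇒∣∁p∣≡k : ∀ {n k} (p : Subset n) → ∣ p ∣ ≡ n ∸ k → k ≤ n → ∣ ∁ p ∣ ≡ k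
  ∣p∣≡n∸k⇒∣∁p∣≡k {n} {k} p ∣p∣≡n∸k k≤n = begin
    ∣ ∁ p ∣      ≡⟨ ∣∁p∣≡n∸∣p∣ p ⟩
    n ∸ ∣ p ∣    ≡⟨ cong (n ∸_) ∣p∣≡n∸k ⟩
    n ∸ (n ∸ k)  ≡⟨ ℕₚ.m∸[m∸n]≡n k≤n ⟩
    k            ∎

  x⊓u+y⊓z≡min-of-sums : ∀ x y z u → x ⊓ u + y ⊓ z ≡ (x + y) ⊓ (x + z) ⊓ (y + u) ⊓ (z + u)
  x⊓u+y⊓z≡min-of-sums x y z u = begin
    x ⊓ u + y ⊓ z                                ≡⟨ ℕₚ.+-distribʳ-⊓ (y ⊓ z) x u ⟩
    (x + y ⊓ z) ⊓ (u + y ⊓ z)                    ≡⟨ cong₂ _⊓_ (ℕₚ.+-distribˡ-⊓ x y z) (ℕₚ.+-distribˡ-⊓ u y z) ⟩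
    (x + y) ⊓ (x + z) ⊓ ((u + y) ⊓ (u + z))      ≡⟨ ≡.sym (ℕₚ.⊓-assoc ((x + y) ⊓ (x + z)) _ _) ⟩
    (x + y) ⊓ (x + z) ⊓ (u + y) ⊓ (u + z)        ≡⟨ cong₂ (λ a b → (x + y) ⊓ (x + z) ⊓ a ⊓ b) (ℕₚ.+-comm u y) (ℕₚ.+-comm u z) ⟩
    (x + y) ⊓ (x + z) ⊓ (y + u) ⊓ (z + u)        ∎

  ball-distances-sum : ∀ {n v k} (L A : Subset n) → ∣ L ∣ ≡ v → ∣ A ∣ ≡ n ∸ k → k ≤ n →
    ∣ L ─ ∁ A ∣ ⊓ ∣ ∁ A ─ L ∣ + ∣ L ─ A ∣ ⊓ ∣ A ─ L ∣ ≡ Rnum n v k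
  ball-distances-sum {n} {v} {k} L A ∣L∣≡v ∣A∣≡n∸k k≤n = ≡.trans (x⊓u+y⊓z≡min-of-sums x y z u)
    (cong₂ _⊓_ (cong₂ _⊓_ (cong₂ _⊓_ x+y≡v x+z≡n∸k) y+u≡k) z+u≡n∸v)
    where
    x y z u : ℕ
    x = ∣ L ─ ∁ A ∣
    y = ∣ L ─ A ∣
    z = ∣ A ─ L ∣
    u = ∣ ∁ A ─ L ∣
    x+y≡v : x + y ≡ v
    x+z≡n∸k : x + z ≡ n ∸ k
    y+u≡k : y + u ≡ k
    z+u≡n∸v : z + u ≡ n ∸ v
    x+y≡v = ≡.trans (∣p─∁q∣+∣p─q∣≡∣p∣ L A) ∣L∣≡v
    x+z≡n∸k = ≡.trans (∣p─∁q∣+∣q─p∣≡∣q∣ L A) ∣A∣≡n∸k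
    y+u≡k = ≡.trans (∣p─q∣+∣∁q─p∣≡∣∁q∣ L A) (∣p∣≡n∸k⇒∣∁p∣≡k A ∣A∣≡n∸k k≤n)
    z+u≡n∸v = ≡.trans (∣q─p∣+∣∁q─p∣≡∣∁p∣ L A) (≡.trans (∣∁p∣≡n∸∣p∣ L) (cong (n ∸_) ∣L∣≡v))

y≤x+y-r-1⇔x≰r : ∀ x y (r : ℤ) → (+ y Int.≤ (+ (x Nat.+ y) - r) - + 1) ⇔ (¬ (+ x Int.≤ r))
y≤x+y-r-1⇔x≰r x y r = mk⇔
  (λ y≤ → ℤₚ.<⇒≱ (ℤₚ.suc[i]≤j⇒i<j (ℤₚ.0≤i-j⇒j≤i (subst (Int.0ℤ Int.≤_) difference (ℤₚ.i≤j⇒0≤j-i y≤)))))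
  (λ x≰r → ℤₚ.0≤i-j⇒j≤i (subst (Int.0ℤ Int.≤_) (≡.sym difference) (ℤₚ.i≤j⇒0≤j-i (ℤₚ.i<j⇒suc[i]≤j (ℤₚ.≰⇒> x≰r)))))
  where
  open +-*-Solver
  difference : ((+ (x Nat.+ y) - r) - + 1) - + y ≡ + x - Int.suc r
  difference rewrite ℤₚ.pos-+ x y =
    solve 3 (λ a b s → ((a :+ b :- s) :- con (+ 1)) :- b := a :- (con (+ 1) :+ s)) refl (+ x) (+ y) r

ball-complement : ∀ {n v k} (r : ℤ) (A : Subset n) → ∣ A ∣ ≡ n ∸ k → k ≤ n → (L : J n v) →
  Ball ((+ Rnum n v k - r) - + 1) A L ⇔ (¬ Ball r (∁ A) L)
ball-complement r A ∣A∣≡n∸k k≤n (L , ∣L∣≡v) =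
  subst (λ R → (+ _ Int.≤ (+ R - r) - + 1) ⇔ _)
        (ball-distances-sum L A ∣L∣≡v ∣A∣≡n∸k k≤n)
        (y≤x+y-r-1⇔x≰r _ _ r)

Enumeration : ∀ {a q} {A : Set a} → Pred A q → ℕ → Set (a ⊔ q)
Enumeration {A = A} Q d =
  Σ[ e ∈ (Fin d → A) ]
    ((∀ i → Q (e i)) × (∀ i j → e i ≡ e j → i ≡ j) × (∀ x → Q x → ∃[ i ] (e i ≡ x)))

enumeration-by-head : ∀ {n q d₁ d₀} {Q : Pred (Subset (Nat.suc n)) q} →
  Enumeration (λ L → Q (true ∷ L)) d₁ → Enumeration (λ L → Q (false ∷ L)) d₀ →
  Enumeration Q (d₁ Nat.+ d₀)
enumeration-by-head {n} {d₁ = d₁} {d₀} {Q} (e₁ , e₁∈Q , e₁-inj , e₁-surj) (e₀ , e₀∈Q , e₀-inj , e₀-surj) =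
  e , e∈Q , e-inj , e-surj
  where
  e⊎ : Fin d₁ ⊎ Fin d₀ → Subset (Nat.suc n)
  e⊎ (inj₁ i) = true ∷ e₁ i
  e⊎ (inj₂ i) = false ∷ e₀ i

  e⊎-inj : ∀ s t → e⊎ s ≡ e⊎ t → s ≡ t
  e⊎-inj (inj₁ i) (inj₁ j) eq = cong inj₁ (e₁-inj i j (Vecₚ.∷-injectiveʳ eq))
  e⊎-inj (inj₂ i) (inj₂ j) eq = cong inj₂ (e₀-inj i j (Vecₚ.∷-injectiveʳ eq))
  e⊎-inj (inj₁ i) (inj₂ j) ()
  e⊎-inj (inj₂ i) (inj₁ j) ()

  e : Fin (d₁ Nat.+ d₀) → Subset (Nat.suc n)
  e i = e⊎ (splitAt d₁ i)

  e∈Q : ∀ i → Q (e i)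
  e∈Q i with splitAt d₁ i
  ... | inj₁ j = e₁∈Q j
  ... | inj₂ j = e₀∈Q j

  e-inj : ∀ i j → e i ≡ e j → i ≡ j
  e-inj i j eq = ≡.trans (≡.sym (Finₚ.join-splitAt d₁ d₀ i))
    (≡.trans (cong (join d₁ d₀) (e⊎-inj _ _ eq)) (Finₚ.join-splitAt d₁ d₀ j))

  e-surj : ∀ L → Q L → ∃[ i ] (e i ≡ L)
  e-surj (true ∷ L) q with e₁-surj L q
  ... | j , refl = j ↑ˡ d₀ , cong e⊎ (Finₚ.splitAt-↑ˡ d₁ j d₀)
  e-surj (false ∷ L) q with e₀-surj L q
  ... | j , refl = d₁ ↑ʳ j , cong e⊎ (Finₚ.splitAt-↑ʳ d₁ d₀ j)

enumerate-subsets : ∀ n {q} (Q : Pred (Subset n) q) → Decidable Q → ∃[ d ] Enumeration Q d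
enumerate-subsets Nat.zero Q Q? with Q? []
... | yes []∈Q = 1 , (λ _ → []) , (λ _ → []∈Q) , (λ { zero zero _ → refl }) , λ { [] _ → zero , refl }
... | no  []∉Q = 0 , (λ ()) , (λ ()) , (λ ()) , λ { [] []∈Q → contradiction []∈Q []∉Q }
enumerate-subsets (Nat.suc n) Q Q?
  with enumerate-subsets n (λ L → Q (true ∷ L)) (λ L → Q? (true ∷ L))
     | enumerate-subsets n (λ L → Q (false ∷ L)) (λ L → Q? (false ∷ L))
... | d₁ , enum₁ | d₀ , enum₀ = d₁ Nat.+ d₀ , enumeration-by-head enum₁ enum₀

module _ {n v : ℕ} where

  J-≡ : {L M : J n v} → proj₁ L ≡ proj₁ M → L ≡ M
  J-≡ {L , p} {.L , q} refl = cong (L ,_) (ℕₚ.≡-irrelevant p q)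

  card-of-decidable : ∀ {p} (P : Pred (J n v) p) → Decidable P → ∃[ d ] Card P d
  card-of-decidable P P? = toCard (enumerate-subsets n Q Q?)
    where
    Q : Pred (Subset n) _
    Q L = Σ (∣ L ∣ ≡ v) (λ ∣L∣≡v → P (L , ∣L∣≡v))

    Q? : Decidable Q
    Q? L with ∣ L ∣ Nat.≟ v
    ... | no ∣L∣≢v = no (∣L∣≢v ∘ proj₁)
    ... | yes ∣L∣≡v = map′ (∣L∣≡v ,_)
      (λ { (p , L∈P) → subst (λ p → P (L , p)) (ℕₚ.≡-irrelevant p ∣L∣≡v) L∈P })
      (P? (L , ∣L∣≡v))

    toCard : ∃[ d ] Enumeration Q d → ∃[ d ] Card P d
    toCard (d , e , e∈Q , e-inj , e-surj) =
      d , (λ i → e i , proj₁ (e∈Q i)) , (λ i → proj₂ (e∈Q i)) , e-inj ,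
      λ { (L , ∣L∣≡v) L∈P → e-surj L (∣L∣≡v , L∈P) }

  Card-surjective : ∀ {p} {P : Pred (J n v) p} {d} (card : Card P d) {M} → P M →
    ∃[ j ] (proj₁ card j ≡ M)
  Card-surjective (_ , _ , _ , surj) {M} M∈P = map₂ J-≡ (surj M M∈P)

module Sums {c ℓ : Level} (F : Field c ℓ) where
  open Field F hiding (zero) renaming (refl to ≈-refl; sym to ≈-sym; trans to ≈-trans)
  open import Algebra.Properties.CommutativeSemigroup +-commutativeSemigroup using (interchange)
  open import Relation.Binary.Reasoning.Setoid setoid

  sumSubsets-cong : ∀ n {f g : Subset n → Carrier} → (∀ L → f L ≈ g L) →
    sumSubsets F n f ≈ sumSubsets F n g
  sumSubsets-cong Nat.zero    f≈g = f≈g []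
  sumSubsets-cong (Nat.suc n) f≈g =
    +-cong (sumSubsets-cong n (f≈g ∘ (true ∷_))) (sumSubsets-cong n (f≈g ∘ (false ∷_)))

  sumSubsets-zero : ∀ n {f : Subset n → Carrier} → (∀ L → f L ≈ 0#) → sumSubsets F n f ≈ 0#
  sumSubsets-zero Nat.zero    f≈0 = f≈0 []
  sumSubsets-zero (Nat.suc n) f≈0 =
    ≈-trans (+-cong (sumSubsets-zero n (f≈0 ∘ (true ∷_))) (sumSubsets-zero n (f≈0 ∘ (false ∷_))))
            (+-identityʳ 0#)

  sumSubsets-+ : ∀ n (f g : Subset n → Carrier) →
    sumSubsets F n (λ L → f L + g L) ≈ sumSubsets F n f + sumSubsets F n g
  sumSubsets-+ Nat.zero    f g = ≈-refl
  sumSubsets-+ (Nat.suc n) f g =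
    ≈-trans (+-cong (sumSubsets-+ n _ _) (sumSubsets-+ n _ _)) (interchange _ _ _ _)

  sumSubsets-* : ∀ n a (f : Subset n → Carrier) →
    sumSubsets F n (λ L → a * f L) ≈ a * sumSubsets F n f
  sumSubsets-* Nat.zero    a f = ≈-refl
  sumSubsets-* (Nat.suc n) a f =
    ≈-trans (+-cong (sumSubsets-* n a _) (sumSubsets-* n a _)) (≈-sym (distribˡ a _ _))

  sumSubsets-single : ∀ n (L₀ : Subset n) (f : Subset n → Carrier) →
    (∀ L → L ≢ L₀ → f L ≈ 0#) → sumSubsets F n f ≈ f L₀
  sumSubsets-single Nat.zero [] f _ = ≈-refl
  sumSubsets-single (Nat.suc n) (true ∷ L₀) f off = begin
    sumSubsets F n (f ∘ (true ∷_)) + sumSubsets F n (f ∘ (false ∷_))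
      ≈⟨ +-cong (sumSubsets-single n L₀ _ (λ L L≢L₀ → off (true ∷ L) (L≢L₀ ∘ Vecₚ.∷-injectiveʳ)))
                (sumSubsets-zero n (λ L → off (false ∷ L) λ ())) ⟩
    f (true ∷ L₀) + 0#  ≈⟨ +-identityʳ _ ⟩
    f (true ∷ L₀)       ∎
  sumSubsets-single (Nat.suc n) (false ∷ L₀) f off = begin
    sumSubsets F n (f ∘ (true ∷_)) + sumSubsets F n (f ∘ (false ∷_))
      ≈⟨ +-cong (sumSubsets-zero n (λ L → off (true ∷ L) λ ()))
                (sumSubsets-single n L₀ _ (λ L L≢L₀ → off (false ∷ L) (L≢L₀ ∘ Vecₚ.∷-injectiveʳ))) ⟩
    0# + f (false ∷ L₀)  ≈⟨ +-identityˡ _ ⟩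
    f (false ∷ L₀)       ∎

  sumFin-cong : ∀ d {f g : Fin d → Carrier} → (∀ i → f i ≈ g i) → sumFin F d f ≈ sumFin F d g
  sumFin-cong Nat.zero    f≈g = ≈-refl
  sumFin-cong (Nat.suc d) f≈g = +-cong (f≈g zero) (sumFin-cong d (f≈g ∘ suc))

  sumFin-zero : ∀ d {f : Fin d → Carrier} → (∀ i → f i ≈ 0#) → sumFin F d f ≈ 0#
  sumFin-zero Nat.zero    f≈0 = ≈-refl
  sumFin-zero (Nat.suc d) f≈0 = ≈-trans (+-cong (f≈0 zero) (sumFin-zero d (f≈0 ∘ suc))) (+-identityʳ 0#)

  sumFin-single : ∀ d (f : Fin d → Carrier) j → (∀ i → i ≢ j → f i ≈ 0#) → sumFin F d f ≈ f j
  sumFin-single (Nat.suc d) f zero off =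
    ≈-trans (+-congˡ (sumFin-zero d (λ i → off (suc i) λ ()))) (+-identityʳ _)
  sumFin-single (Nat.suc d) f (suc j) off =
    ≈-trans (+-cong (off zero λ ()) (sumFin-single d (f ∘ suc) j (λ i i≢j → off (suc i) (i≢j ∘ Finₚ.suc-injective))))
            (+-identityˡ _)

module Coordinates {c ℓ : Level} (F : Field c ℓ) (n v : ℕ) where
  open Field F hiding (zero) renaming (refl to ≈-refl; sym to ≈-sym; trans to ≈-trans)
  open import Algebra.Properties.CommutativeSemigroup *-commutativeSemigroup using (x∙yz≈y∙xz)
  open import Relation.Binary.Reasoning.Setoid setoid
  open Sums F

  extendByZero : (J n v → Carrier) → Subset n → Carrier
  extendByZero f L with ∣ L ∣ Nat.≟ v
  ... | yes ∣L∣≡v = f (L , ∣L∣≡v)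
  ... | no  _     = 0#

  sumJ : (J n v → Carrier) → Carrier
  sumJ f = sumSubsets F n (extendByZero f)

  sumJ-cong : ∀ {f g : J n v → Carrier} → (∀ M → f M ≈ g M) → sumJ f ≈ sumJ g
  sumJ-cong {f} {g} f≈g = sumSubsets-cong n lifted
    where
    lifted : ∀ L → extendByZero f L ≈ extendByZero g L
    lifted L with ∣ L ∣ Nat.≟ v
    ... | yes ∣L∣≡v = f≈g (L , ∣L∣≡v)
    ... | no  _     = ≈-refl

  sumJ-zero : ∀ {f : J n v → Carrier} → (∀ M → f M ≈ 0#) → sumJ f ≈ 0#
  sumJ-zero {f} f≈0 = sumSubsets-zero n lifted
    where
    lifted : ∀ L → extendByZero f L ≈ 0#
    lifted L with ∣ L ∣ Nat.≟ v
    ... | yes ∣L∣≡v = f≈0 (L , ∣L∣≡v)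
    ... | no  _     = ≈-refl

  sumJ-+ : ∀ (f g : J n v → Carrier) → sumJ (λ M → f M + g M) ≈ sumJ f + sumJ g
  sumJ-+ f g = ≈-trans (sumSubsets-cong n lifted) (sumSubsets-+ n _ _)
    where
    lifted : ∀ L → extendByZero (λ M → f M + g M) L ≈ extendByZero f L + extendByZero g L
    lifted L with ∣ L ∣ Nat.≟ v
    ... | yes _ = ≈-refl
    ... | no  _ = ≈-sym (+-identityʳ 0#)

  sumJ-* : ∀ a (f : J n v → Carrier) → sumJ (λ M → a * f M) ≈ a * sumJ f
  sumJ-* a f = ≈-trans (sumSubsets-cong n lifted) (sumSubsets-* n a _)
    where
    lifted : ∀ L → extendByZero (λ M → a * f M) L ≈ a * extendByZero f L
    lifted L with ∣ L ∣ Nat.≟ v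
    ... | yes _ = ≈-refl
    ... | no  _ = ≈-sym (zeroʳ a)

  sumJ-single : ∀ L₀ (f : J n v → Carrier) → (∀ L → proj₁ L ≢ proj₁ L₀ → f L ≈ 0#) → sumJ f ≈ f L₀
  sumJ-single (L₀ , ∣L₀∣≡v) f off = ≈-trans (sumSubsets-single n L₀ (extendByZero f) vanishes) atL₀
    where
    vanishes : ∀ L → L ≢ L₀ → extendByZero f L ≈ 0#
    vanishes L L≢L₀ with ∣ L ∣ Nat.≟ v
    ... | yes ∣L∣≡v = off (L , ∣L∣≡v) L≢L₀
    ... | no  _     = ≈-refl
    atL₀ : extendByZero f L₀ ≈ f (L₀ , ∣L₀∣≡v)
    atL₀ with ∣ L₀ ∣ Nat.≟ v
    ... | yes p     = reflexive (cong (λ p → f (L₀ , p)) (ℕₚ.≡-irrelevant p ∣L₀∣≡v))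
    ... | no  ∣L₀∣≢v = contradiction ∣L₀∣≡v ∣L₀∣≢v

  infixl 7 _·_
  _·_ : Word F n v → Word F n v → Carrier
  w · w′ = sumJ (λ M → w M * w′ M)

  ⟨,⟩≈· : ∀ w w′ → ⟨_,_⟩ F w w′ ≈ w · w′
  ⟨,⟩≈· w w′ = sumSubsets-cong n same
    where
    same : ∀ L → termAt F w w′ L ≈ extendByZero (λ M → w M * w′ M) L
    same L with ∣ L ∣ Nat.≟ v
    ... | yes _ = ≈-refl
    ... | no  _ = ≈-refl

  unit : J n v → Word F n v
  unit L M = if does (Vecₚ.≡-dec Bool._≟_ (proj₁ L) (proj₁ M)) then 1# else 0#

  unit-refl : ∀ L → unit L L ≈ 1#
  unit-refl L rewrite dec-true (Vecₚ.≡-dec Bool._≟_ (proj₁ L) (proj₁ L)) refl = ≈-refl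

  unit-≢ : ∀ L M → proj₁ L ≢ proj₁ M → unit L M ≈ 0#
  unit-≢ L M neq rewrite dec-false (Vecₚ.≡-dec Bool._≟_ (proj₁ L) (proj₁ M)) neq = ≈-refl

  ·-unit : ∀ w L → w · unit L ≈ w L
  ·-unit w L = begin
    w · unit L        ≈⟨ sumJ-single L _ (λ M M≢L → ≈-trans (*-congˡ (unit-≢ L M (M≢L ∘ ≡.sym))) (zeroʳ _)) ⟩
    w L * unit L L    ≈⟨ *-congˡ (unit-refl L) ⟩
    w L * 1#          ≈⟨ *-identityʳ _ ⟩
    w L               ∎

  ·-lincomb : ∀ w {d} (a : Fin d → Carrier) (b : Fin d → Word F n v) →
    w · lincomb F a b ≈ sumFin F d (λ i → a i * (w · b i))
  ·-lincomb w {Nat.zero}  a b = sumJ-zero (λ M → zeroʳ (w M))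
  ·-lincomb w {Nat.suc d} a b = begin
    sumJ (λ M → w M * (a zero * b zero M + lincomb F (a ∘ suc) (b ∘ suc) M))
      ≈⟨ sumJ-cong (λ M → ≈-trans (distribˡ _ _ _) (+-congʳ (x∙yz≈y∙xz _ _ _))) ⟩
    sumJ (λ M → a zero * (w M * b zero M) + w M * lincomb F (a ∘ suc) (b ∘ suc) M)
      ≈⟨ sumJ-+ _ _ ⟩
    sumJ (λ M → a zero * (w M * b zero M)) + w · lincomb F (a ∘ suc) (b ∘ suc)
      ≈⟨ +-cong (sumJ-* _ _) (·-lincomb w (a ∘ suc) (b ∘ suc)) ⟩
    a zero * (w · b zero) + sumFin F d (λ i → a (suc i) * (w · b (suc i)))
      ∎

  lincomb-at : ∀ {p} {P : Pred (J n v) p} {d} (card : Card P d)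
    {a : Fin d → Carrier} {b : Fin d → Word F n v} →
    (∀ i {M} → P M → b i M ≈ unit (proj₁ card i) M) →
    ∀ j → lincomb F a b (proj₁ card j) ≈ a j
  lincomb-at {d = d} (e , e∈P , e-inj , _) {a} {b} b≈unit j = begin
    sumFin F d (λ i → a i * b i (e j))       ≈⟨ sumFin-cong d (λ i → *-congˡ (b≈unit i (e∈P j))) ⟩
    sumFin F d (λ i → a i * unit (e i) (e j))
      ≈⟨ sumFin-single d _ j (λ i i≢j → ≈-trans (*-congˡ (unit-≢ (e i) (e j) (i≢j ∘ e-inj i j))) (zeroʳ _)) ⟩
    a j * unit (e j) (e j)                    ≈⟨ *-congˡ (unit-refl (e j)) ⟩
    a j * 1#                                  ≈⟨ *-identityʳ _ ⟩
    a j                                       ∎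

  lincomb-closed : ∀ {ℓ′} {D : Pred (Word F n v) ℓ′} → IsLinearCode F D →
    ∀ {d} {a : Fin d → Carrier} {b : Fin d → Word F n v} → (∀ i → D (b i)) → D (lincomb F a b)
  lincomb-closed D-linear {Nat.zero}  b∈D = IsLinearCode.has-zero D-linear
  lincomb-closed D-linear {Nat.suc d} {a} b∈D =
    IsLinearCode.closed-+ D-linear (IsLinearCode.closed-* D-linear (a zero) (b∈D zero))
                                   (lincomb-closed D-linear (b∈D ∘ suc))

  module _ {ℓ′} (C : Pred (Word F n v) ℓ′) where

    ∈Dual⇒ : ∀ {w c′} → Dual F C w → C c′ → w · c′ ≈ 0#
    ∈Dual⇒ {w} {c′} w∈C⊥ c′∈C = ≈-trans (≈-sym (⟨,⟩≈· w c′)) (w∈C⊥ c′ c′∈C)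

    ⇒∈Dual : ∀ {w} → (∀ c′ → C c′ → w · c′ ≈ 0#) → Dual F C w
    ⇒∈Dual {w} w⊥C c′ c′∈C = ≈-trans (⟨,⟩≈· w c′) (w⊥C c′ c′∈C)

    Dual-isLinearCode : IsLinearCode F (Dual F C)
    Dual-isLinearCode = record
      { respects = λ w≋w′ w∈C⊥ → ⇒∈Dual λ c′ c′∈C →
          ≈-trans (sumJ-cong (λ M → *-congʳ (≈-sym (w≋w′ M)))) (∈Dual⇒ w∈C⊥ c′∈C)
      ; has-zero = ⇒∈Dual λ c′ _ → sumJ-zero (λ M → zeroˡ (c′ M))
      ; closed-+ = λ {w} {w′} w∈C⊥ w′∈C⊥ → ⇒∈Dual λ c′ c′∈C → begin
          (w ⊕′ w′) · c′     ≈⟨ sumJ-cong (λ M → distribʳ (c′ M) (w M) (w′ M)) ⟩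
          sumJ (λ M → w M * c′ M + w′ M * c′ M) ≈⟨ sumJ-+ _ _ ⟩
          w · c′ + w′ · c′   ≈⟨ +-cong (∈Dual⇒ w∈C⊥ c′∈C) (∈Dual⇒ w′∈C⊥ c′∈C) ⟩
          0# + 0#            ≈⟨ +-identityʳ 0# ⟩
          0#                 ∎
      ; closed-* = λ a {w} w∈C⊥ → ⇒∈Dual λ c′ c′∈C → begin
          (a ⊛′ w) · c′      ≈⟨ sumJ-cong (λ M → *-assoc a (w M) (c′ M)) ⟩
          sumJ (λ M → a * (w M * c′ M)) ≈⟨ sumJ-* a _ ⟩
          a * (w · c′)       ≈⟨ *-congˡ (∈Dual⇒ w∈C⊥ c′∈C) ⟩
          a * 0#             ≈⟨ zeroʳ a ⟩
          0#                 ∎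
      }
      where
      _⊕′_ = _⊕_ F
      _⊛′_ = _⊛_ F

module ComplementOfInformationSet
  {c ℓ ℓ′ ℓs ℓt : Level} (F : Field c ℓ) {n v : ℕ}
  (C : Pred (Word F n v) ℓ′) (C-linear : IsLinearCode F C)
  (S : Pred (J n v) ℓs) (S? : Decidable S) (S-info : IsInformationSet F C S)
  (T : Pred (J n v) ℓt) (T-irrelevant : ∀ {L} → Irrelevant (T L)) (T⇔∉S : ∀ L → T L ⇔ (¬ S L))
  where

  open Field F hiding (zero) renaming (refl to ≈-refl; sym to ≈-sym; trans to ≈-trans)
  open import Algebra.Properties.Group +-group using (inverseˡ-unique)
  open import Relation.Binary.Reasoning.Setoid setoid
  open Sums F
  open Coordinates F n v

  private
    T⇒∉S : ∀ {L} → T L → ¬ S L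
    T⇒∉S = Equivalence.to (T⇔∉S _)

    ∉S⇒T : ∀ {L} → ¬ S L → T L
    ∉S⇒T = Equivalence.from (T⇔∉S _)

    dS : ℕ
    dS = proj₁ (proj₁ S-info)

    S-card : Card S dS
    S-card = proj₂ (proj₂ (proj₁ S-info))

    eS : Fin dS → J n v
    eS = proj₁ S-card

  C-determined : ∀ w w′ → C w → C w′ → (∀ L → S L → w L ≈ w′ L) → _≋_ F w w′
  C-determined = proj₁ (proj₂ S-info)

  C-extends : ∀ (f : Σ (J n v) S → Carrier) → ∃[ w ] (C w × (∀ L (s : S L) → w L ≈ f (L , s)))
  C-extends = proj₂ (proj₂ S-info)

  unitCodeword : J n v → Word F n v
  unitCodeword L = proj₁ (C-extends (unit L ∘ proj₁))

  unitCodeword-∈C : ∀ L → C (unitCodeword L)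
  unitCodeword-∈C L = proj₁ (proj₂ (C-extends (unit L ∘ proj₁)))

  unitCodeword-onS : ∀ L {M} → S M → unitCodeword L M ≈ unit L M
  unitCodeword-onS L {M} = proj₂ (proj₂ (C-extends (unit L ∘ proj₁))) M

  C-spanned : ∀ {c′} → C c′ → _≋_ F c′ (lincomb F (c′ ∘ eS) (unitCodeword ∘ eS))
  C-spanned {c′} c′∈C = C-determined _ _ c′∈C (lincomb-closed C-linear (unitCodeword-∈C ∘ eS)) agree
    where
    agree : ∀ M → S M → c′ M ≈ lincomb F (c′ ∘ eS) (unitCodeword ∘ eS) M
    agree M M∈S with Card-surjective S-card M∈S
    ... | j , refl = ≈-sym (lincomb-at S-card (unitCodeword-onS ∘ eS) j)

  ⊥unitCodewords⇒∈Dual : ∀ {w} → (∀ L → S L → w · unitCodeword L ≈ 0#) → Dual F C w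
  ⊥unitCodewords⇒∈Dual {w} w⊥ = ⇒∈Dual C λ c′ c′∈C → begin
    w · c′                                                    ≈⟨ sumJ-cong (λ M → *-congˡ (C-spanned c′∈C M)) ⟩
    w · lincomb F (c′ ∘ eS) (unitCodeword ∘ eS)               ≈⟨ ·-lincomb w (c′ ∘ eS) (unitCodeword ∘ eS) ⟩
    sumFin F dS (λ i → c′ (eS i) * (w · unitCodeword (eS i)))
      ≈⟨ sumFin-zero dS (λ i → ≈-trans (*-congˡ (w⊥ (eS i) (proj₁ (proj₂ S-card) i))) (zeroʳ _)) ⟩
    0#                                                        ∎

  offS : Word F n v → Word F n v
  offS w M = if does (S? M) then 0# else w M

  ·-unitCodeword : ∀ w {L} → S L → w · unitCodeword L ≈ w L + offS w · unitCodeword L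
  ·-unitCodeword w {L} L∈S = begin
    w · unitCodeword L                                             ≈⟨ sumJ-cong split ⟩
    sumJ (λ M → w M * unit L M + offS w M * unitCodeword L M)      ≈⟨ sumJ-+ _ _ ⟩
    w · unit L + offS w · unitCodeword L                           ≈⟨ +-congʳ (·-unit w L) ⟩
    w L + offS w · unitCodeword L                                  ∎
    where
    split : ∀ M → w M * unitCodeword L M ≈ w M * unit L M + offS w M * unitCodeword L M
    split M with S? M
    ... | yes M∈S = ≈-trans (*-congˡ (unitCodeword-onS L M∈S))
                            (≈-sym (≈-trans (+-congˡ (zeroˡ _)) (+-identityʳ _)))
    ... | no  M∉S = ≈-sym (≈-trans (+-congʳ (≈-trans (*-congˡ (unit-≢ L M L≢M)) (zeroʳ _))) (+-identityˡ _))
      where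
      L≢M : proj₁ L ≢ proj₁ M
      L≢M eq = M∉S (subst S (J-≡ eq) L∈S)

  Dual-onS : ∀ {w L} → Dual F C w → S L → w L ≈ - (offS w · unitCodeword L)
  Dual-onS {w} {L} w∈C⊥ L∈S =
    inverseˡ-unique _ _ (≈-trans (≈-sym (·-unitCodeword w L∈S)) (∈Dual⇒ C w∈C⊥ (unitCodeword-∈C L)))

  Dual-determined : ∀ w w′ → Dual F C w → Dual F C w′ → (∀ L → T L → w L ≈ w′ L) → _≋_ F w w′
  Dual-determined w w′ w∈C⊥ w′∈C⊥ agree M with S? M
  ... | no  M∉S = agree M (∉S⇒T M∉S)
  ... | yes M∈S = begin
    w M                               ≈⟨ Dual-onS w∈C⊥ M∈S ⟩
    - (offS w · unitCodeword M)       ≈⟨ -‿cong (sumJ-cong (λ L → *-congʳ (offS-agree L))) ⟩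
    - (offS w′ · unitCodeword M)      ≈⟨ ≈-sym (Dual-onS w′∈C⊥ M∈S) ⟩
    w′ M                              ∎
    where
    offS-agree : ∀ L → offS w L ≈ offS w′ L
    offS-agree L with S? L
    ... | yes _   = ≈-refl
    ... | no  L∉S = agree L (∉S⇒T L∉S)

  fromT : (Σ (J n v) T → Carrier) → Word F n v
  fromT f M with S? M
  ... | yes _   = 0#
  ... | no  M∉S = f (M , ∉S⇒T M∉S)

  extend : (Σ (J n v) T → Carrier) → Word F n v
  extend f M = if does (S? M) then - (fromT f · unitCodeword M) else fromT f M

  offS-extend : ∀ f M → offS (extend f) M ≈ fromT f M
  offS-extend f M with S? M
  ... | yes _ = ≈-refl
  ... | no  _ = ≈-refl

  extend-onS : ∀ f {L} → S L → extend f L ≈ - (fromT f · unitCodeword L)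
  extend-onS f {L} L∈S with S? L
  ... | yes _   = ≈-refl
  ... | no  L∉S = contradiction L∈S L∉S

  extend-∈Dual : ∀ f → Dual F C (extend f)
  extend-∈Dual f = ⊥unitCodewords⇒∈Dual λ L L∈S → begin
    extend f · unitCodeword L                                 ≈⟨ ·-unitCodeword (extend f) L∈S ⟩
    extend f L + offS (extend f) · unitCodeword L
      ≈⟨ +-cong (extend-onS f L∈S) (sumJ-cong (λ M → *-congʳ (offS-extend f M))) ⟩
    - (fromT f · unitCodeword L) + fromT f · unitCodeword L   ≈⟨ -‿inverseˡ _ ⟩
    0#                                                        ∎

  extend-onT : ∀ f {L} (t : T L) → extend f L ≈ f (L , t)
  extend-onT f {L} t with S? L
  ... | yes L∈S = contradiction L∈S (T⇒∉S t)
  ... | no  _   = reflexive (cong (λ t′ → f (L , t′)) (T-irrelevant _ t))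

  Dual-hasDim : ∀ {d} → Card T d → HasDim F (Dual F C) d
  Dual-hasDim {d} T-card = dualBasis , dualBasis-∈Dual , spans , independent
    where
    eT : Fin d → J n v
    eT = proj₁ T-card

    unitOnT : Fin d → Σ (J n v) T → Carrier
    unitOnT i = unit (eT i) ∘ proj₁

    dualBasis : Fin d → Word F n v
    dualBasis i = extend (unitOnT i)

    dualBasis-∈Dual : ∀ i → Dual F C (dualBasis i)
    dualBasis-∈Dual i = extend-∈Dual (unitOnT i)

    dualBasis-onT : ∀ i {M} → T M → dualBasis i M ≈ unit (eT i) M
    dualBasis-onT i = extend-onT (unitOnT i)

    spans : ∀ w → Dual F C w → ∃[ a ] (_≋_ F w (lincomb F a dualBasis))
    spans w w∈C⊥ = w ∘ eT , Dual-determined w (lincomb F (w ∘ eT) dualBasis) w∈C⊥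
      (lincomb-closed (Dual-isLinearCode C) dualBasis-∈Dual) agree
      where
      agree : ∀ M → T M → w M ≈ lincomb F (w ∘ eT) dualBasis M
      agree M M∈T with Card-surjective T-card M∈T
      ... | j , refl = ≈-sym (lincomb-at T-card dualBasis-onT j)

    independent : ∀ a → _≋_ F (lincomb F a dualBasis) (zeroW F) → ∀ i → a i ≈ 0#
    independent a a≋0 j = ≈-trans (≈-sym (lincomb-at T-card dualBasis-onT j)) (a≋0 (eT j))

  complement-isInformationSet : IsInformationSet F (Dual F C) T
  complement-isInformationSet with card-of-decidable T (λ L → map′ ∉S⇒T T⇒∉S (¬? (S? L)))
  ... | d , T-card =
    (d , Dual-hasDim T-card , T-card) , Dual-determined , λ f → extend f , extend-∈Dual f , λ L → extend-onT f

with-dimension : ∀ {c ℓ ℓ′ ℓs} (F : Field c ℓ) {n v} {D : Pred (Word F n v) ℓ′} {S : Pred (J n v) ℓs} →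
  IsInformationSet F D S → ∃[ d ] ((HasDim F D d × Card S d) × IsInformationSet F D S)
with-dimension F info@((d , dim , card) , _) = d , (dim , card) , info

proposition12 : ∀ {c ℓ ℓ' : Level} (F : Field c ℓ) (n v k : ℕ) (r : ℤ) →
    1 ≤ v → v ≤ n → k ≤ n →
    (C : Pred (Word F n v) ℓ') →
    IsJGC F n v k r C →
    IsJGC F n v (n ∸ k) ((+ Rnum n v k - r) - + 1) (Dual F C)
proposition12 F n v k r _ _ k≤n C (C-linear , C-info) =
  Coordinates.Dual-isLinearCode F n v C , λ A ∣A∣≡n∸k →
    with-dimension F (complement-isInformationSet
      (Ball r (∁ A)) (λ L → _ Int.≤? r) (proj₂ (proj₂ (C-info (∁ A) (∣p∣≡n∸k⇒∣∁p∣≡k A ∣A∣≡n∸k k≤n))))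
      (Ball ((+ Rnum n v k - r) - + 1) A) ℤₚ.≤-irrelevant (ball-complement r A ∣A∣≡n∸k k≤n))
  where
  open ComplementOfInformationSet F C C-linear using (complement-isInformationSet)
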